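{- Let $\mathcal{F}$ be a set of functions from $[0,n-1]$ to $\{0,1\}$ such that (i) $1-f\in\mathcal{F}$ for all $f\in\mathcal{F}$, and (ii) for every $i,j\in[0,n-1]$ with $i\ne j$ there exists $f\in\mathcal{F}$ with $f(i)=1$ and $f(j)=0$. Then there exists $S\subseteq\mathcal{F}$ with $|S|\le\log n$ such that the pointwise product $f_S=\prod_{f\in S}f$ has support of size exactly $1$.
   Context: Logarithms are base 2. -}

module Defs where

open import Data.Bool using (Bool; true; false; _∧_; T)
open import Data.Nat using (ℕ)
open import Data.Fin using (Fin)
open import Data.List using (List; []; _∷_; length; filter; allFin)
open import Data.Bool.Properties using (T?)

-- A {0,1}-valued function on [0,n-1], encoded as Fin n → Bool
-- (true = 1, false = 0).
BFun : ℕ → Set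
BFun n = Fin n → Bool

-- Pointwise product of a finite family of {0,1}-functions
-- (empty product = constant 1).  For Booleans, product = conjunction.
prodS : ∀ {n} → List (BFun n) → BFun n
prodS []       i = true
prodS (f ∷ fs) i = f i ∧ prodS fs i

support : ∀ {n} → BFun n → List (Fin n)
support {n} g = filter (λ i → T? (g i)) (allFin n)

supportSize : ∀ {n} → BFun n → ℕ
supportSize g = length (support g)

-- Grow a list S ⊆ 𝓕 one function at a time, keeping the
-- support of the product g = ∏ S nonempty and keeping the invariant
--   2 ^ |S| * |supp g| ≤ n.
-- Initially S = [] and g ≡ 1, whose support is all of [0,n-1].  If the
-- support of g has two distinct points i ≠ j, take f ∈ 𝓕 separating them
-- (f i = 1, f j = 0); the support of g splits into the supports of f·g and
-- (1-f)·g, both nonempty (they contain i resp. j).  Adding the smaller of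
-- f and 1-f (both in 𝓕) to S at least halves the support, so the
-- invariant survives while the support strictly shrinks.  By strong
-- induction on the support size we reach support size 1, and then
-- 2 ^ |S| ≤ n, i.e. |S| ≤ ⌊log₂ n⌋.
module Submission where

open import Defs
open import Data.Bool using (Bool; true; false; not; _∧_; T)
open import Data.Bool.Properties using (T?)
open import Data.Nat using (ℕ; zero; suc; _≤_; _<_; NonZero; _+_; _*_; _^_; z≤n; s≤s)
open import Data.Nat.Properties
open import Data.Nat.Induction using (<-rec)
open import Data.Nat.Logarithm using (⌊log₂_⌋; ⌊log₂⌋-mono-≤; ⌊log₂[2^n]⌋≡n)
open import Data.Fin using (Fin)
open import Data.List using (List; []; _∷_; length; filter; allFin)
open import Data.List.Properties using (length-tabulate; filter-all)
open import Data.List.Relation.Unary.All using (All; []; _∷_; universal)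
open import Data.List.Relation.Unary.Any using (here; there)
open import Data.List.Membership.Propositional.Properties
  using (∈-filter⁺; ∈-filter⁻; ∈-allFin; ∈-length)
open import Data.List.Relation.Unary.Unique.Propositional.Properties using (allFin⁺; filter⁺)
open import Data.List.Relation.Unary.AllPairs using (_∷_)
open import Data.Product using (Σ; _×_; _,_; proj₂)
open import Data.Sum using (inj₁; inj₂)
open import Data.Unit using (tt)
open import Relation.Nullary using (yes; no)
open import Relation.Binary.PropositionalEquality
  using (_≡_; _≢_; refl; sym; trans; cong; subst; module ≡-Reasoning)
open import Function using (_∘_)

_∧ᶠ_ : ∀ {n} → BFun n → BFun n → BFun n
(f ∧ᶠ g) k = f k ∧ g k

count : ∀ {A : Set} → (A → Bool) → List A → ℕ
count p xs = length (filter (λ x → T? (p x)) xs)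

count-split : ∀ {A : Set} (p q : A → Bool) (xs : List A) →
              count (λ x → p x ∧ q x) xs + count (λ x → not (p x) ∧ q x) xs ≡ count q xs
count-split p q [] = refl
count-split p q (x ∷ xs) with p x | q x
... | true  | true  = cong suc (count-split p q xs)
... | true  | false = count-split p q xs
... | false | true  = trans (+-suc _ _) (cong suc (count-split p q xs))
... | false | false = count-split p q xs

supportSize-split : ∀ {n} (f g : BFun n) →
                    supportSize (f ∧ᶠ g) + supportSize ((not ∘ f) ∧ᶠ g) ≡ supportSize g
supportSize-split {n} f g = count-split f g (allFin n)

supportSize-one : ∀ n → supportSize {n} (prodS []) ≡ n
supportSize-one n = begin
  length (filter (λ _ → T? true) (allFin n)) ≡⟨ cong length (filter-all (λ _ → T? true) (universal (λ _ → tt) (allFin n))) ⟩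
  length (allFin n)                         ≡⟨ length-tabulate _ ⟩
  n                                          ∎
  where open ≡-Reasoning

T-≡ : ∀ {b} → T b → b ≡ true
T-≡ {true} _ = refl

≡-T : ∀ {b} → b ≡ true → T b
≡-T refl = tt

support-nonempty : ∀ {n} (g : BFun n) (i : Fin n) → g i ≡ true → 1 ≤ supportSize g
support-nonempty g i gi = ∈-length (∈-filter⁺ (λ k → T? (g k)) (∈-allFin i) (≡-T gi))

-- A support of size at least two contains two distinct points, because the
-- support is a duplicate-free list (a filter of allFin).
support-two : ∀ {n} (g : BFun n) → 2 ≤ supportSize g →
              Σ (Fin n) λ i → Σ (Fin n) λ j → i ≢ j × g i ≡ true × g j ≡ true
support-two {n} g 2≤ with support g
                        | filter⁺ (λ k → T? (g k)) (allFin⁺ n)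
                        | (λ {v} → ∈-filter⁻ (λ k → T? (g k)) {v} {allFin n})
support-two g (s≤s ()) | _ ∷ [] | _ | _
... | i ∷ j ∷ _ | (i≢j ∷ _) ∷ _ | member =
  i , j , i≢j , T-≡ (proj₂ (member (here refl))) , T-≡ (proj₂ (member (there (here refl))))

smaller-half : ∀ {a b c} → a ≤ b → a + b ≡ c → 2 * a ≤ c
smaller-half {a} {b} a≤b refl = +-monoʳ-≤ a (≤-trans (≤-reflexive (+-identityʳ a)) a≤b)

half-< : ∀ {a c} → 1 ≤ a → 2 * a ≤ c → a < c
half-< {a} {c} 1≤a 2a≤c = <-≤-trans (m<m+n a 1≤a) (subst (_≤ c) (cong (a +_) (+-identityʳ a)) 2a≤c)

double-invariant : ∀ k s s′ n → 2 * s′ ≤ s → 2 ^ k * s ≤ n → 2 ^ suc k * s′ ≤ n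
double-invariant k s s′ n 2s′≤s inv = begin
  2 ^ suc k * s′   ≡⟨ *-assoc 2 (2 ^ k) s′ ⟩
  2 * (2 ^ k * s′) ≡⟨ cong (2 *_) (*-comm (2 ^ k) s′) ⟩
  2 * (s′ * 2 ^ k) ≡⟨ sym (*-assoc 2 s′ (2 ^ k)) ⟩
  2 * s′ * 2 ^ k   ≡⟨ *-comm (2 * s′) (2 ^ k) ⟩
  2 ^ k * (2 * s′) ≤⟨ *-monoʳ-≤ (2 ^ k) 2s′≤s ⟩
  2 ^ k * s        ≤⟨ inv ⟩
  n                ∎
  where open ≤-Reasoning

≤-log₂ : ∀ k n → 2 ^ k ≤ n → k ≤ ⌊log₂ n ⌋
≤-log₂ k n 2^k≤n = subst (_≤ ⌊log₂ n ⌋) (⌊log₂[2^n]⌋≡n k) (⌊log₂⌋-mono-≤ 2^k≤n)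

module Construction (n : ℕ) (𝓕 : BFun n → Set)
  (closed : ∀ f → 𝓕 f → 𝓕 (not ∘ f))
  (separating : ∀ (i j : Fin n) → i ≢ j → Σ (BFun n) (λ f → 𝓕 f × (f i ≡ true) × (f j ≡ false)))
  where

  shrink : (g : BFun n) → 2 ≤ supportSize g →
           Σ (BFun n) λ h → 𝓕 h × 1 ≤ supportSize (h ∧ᶠ g) × 2 * supportSize (h ∧ᶠ g) ≤ supportSize g
  shrink g 2≤ with support-two g 2≤
  ... | i , j , i≢j , gi , gj with separating i j i≢j
  ... | f , 𝓕f , fi , fj with ≤-total (supportSize (f ∧ᶠ g)) (supportSize ((not ∘ f) ∧ᶠ g))
  ... | inj₁ f≤¬f = f , 𝓕f , i∈f , smaller-half f≤¬f (supportSize-split f g)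
    where
      i∈f : 1 ≤ supportSize (f ∧ᶠ g)
      i∈f = support-nonempty (f ∧ᶠ g) i (subst (λ b → b ∧ g i ≡ true) (sym fi) gi)
  ... | inj₂ ¬f≤f = not ∘ f , closed f 𝓕f , j∈¬f ,
                    smaller-half ¬f≤f (trans (+-comm (supportSize ((not ∘ f) ∧ᶠ g)) (supportSize (f ∧ᶠ g)))
                                                   (supportSize-split f g))
    where
      j∈¬f : 1 ≤ supportSize ((not ∘ f) ∧ᶠ g)
      j∈¬f = support-nonempty ((not ∘ f) ∧ᶠ g) j (subst (λ b → not b ∧ g j ≡ true) (sym fj) gj)

  Witness : Set
  Witness = Σ (List (BFun n)) (λ S → All 𝓕 S × (length S ≤ ⌊log₂ n ⌋) × (supportSize (prodS S) ≡ 1))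

  Invariant : List (BFun n) → Set
  Invariant S = All 𝓕 S × 1 ≤ supportSize (prodS S) × 2 ^ length S * supportSize (prodS S) ≤ n

  refine : ∀ s (S : List (BFun n)) → supportSize (prodS S) ≡ s → Invariant S → Witness
  refine = <-rec _ step
    where
      step : ∀ s → (∀ {s′} → s′ < s → ∀ S → supportSize (prodS S) ≡ s′ → Invariant S → Witness) →
             ∀ S → supportSize (prodS S) ≡ s → Invariant S → Witness
      step s recurse S refl (𝓕S , 1≤s , inv) with s ≟ 1
      ... | yes s≡1 = S , 𝓕S , ≤-log₂ (length S) n 2^|S|≤n , s≡1
        where
          2^|S|≤n : 2 ^ length S ≤ n
          2^|S|≤n = ≤-trans (≤-reflexive (sym (*-identityʳ _)))
                            (subst (λ t → 2 ^ length S * t ≤ n) s≡1 inv)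
      ... | no s≢1 with shrink (prodS S) (≤∧≢⇒< 1≤s (s≢1 ∘ sym))
      ... | h , 𝓕h , 1≤s′ , 2s′≤s =
        recurse (half-< 1≤s′ 2s′≤s) (h ∷ S) refl
                (𝓕h ∷ 𝓕S , 1≤s′ , double-invariant (length S) s _ n 2s′≤s inv)

lemma4p1 : (n : ℕ) → .{{_ : NonZero n}} → (𝓕 : BFun n → Set) →
    (∀ f → 𝓕 f → 𝓕 (not ∘ f)) →
    (∀ (i j : Fin n) → i ≢ j → Σ (BFun n) (λ f → 𝓕 f × (f i ≡ true) × (f j ≡ false))) →
    Σ (List (BFun n)) (λ S → All 𝓕 S × (length S ≤ ⌊log₂ n ⌋) × (supportSize (prodS S) ≡ 1))
lemma4p1 n@(suc _) 𝓕 closed separating =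
  Construction.refine n 𝓕 closed separating n [] (supportSize-one n)
    ([] , subst (1 ≤_) (sym (supportSize-one n)) (s≤s z≤n)
        , ≤-reflexive (trans (+-identityʳ _) (supportSize-one n)))
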